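{- Let $p$ be any distribution over $[n]$. Let $\mathcal I=\{I_i\}_{i=1}^{a}$ be a $(p,\epsilon,a)$-flat decomposition of $[n]$, and let $\mathcal J=\{J_i\}_{i=1}^{b}$ be a refinement of $\mathcal I$. Then $\mathcal J$ is a $(p,2\epsilon,b)$-flat decomposition of $[n]$.
   Context: A distribution over $[n]=\{1,\dots,n\}$ is a function $p:[n]\to[0,1]$ with $\sum_i p(i)=1$; write $p(S)=\sum_{i\in S}p(i)$. Let $d_{\mathrm{TV}}(p,q)=\frac12\sum_i|p(i)-q(i)|$. For a partition $\mathcal I=\{I_j\}_{j=1}^{\ell}$ of $[n]$ into disjoint intervals, the flattened distribution $(p_f)^{\mathcal I}$ over $[n]$ is given by $(p_f)^{\mathcal I}(i)=p(I_j)/|I_j|$ for $i\in I_j$. The partition $\mathcal I$ is a $(p,\epsilon,\ell)$-flat decomposition of $[n]$ if $d_{\mathrm{TV}}(p,(p_f)^{\mathcal I})\le\epsilon$. A partition $\mathcal J=\{J_j\}_{j=1}^b$ of $[n]$ into intervals is a refinement of $\mathcal I=\{I_i\}_{i=1}^a$ if every $I_i$ is a union of intervals of $\mathcal J$.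
   Formalization: The distribution p takes rational values and the parameter ε is rational. -}

module Defs where

open import Data.Nat as ℕ using (ℕ; zero; suc; _∸_)
open import Data.Nat.Properties using (_≤?_)
open import Data.Fin using (Fin; toℕ)
import Data.Fin as Fin
open import Data.Integer using (+_)
open import Data.Rational using (ℚ; 0ℚ; 1ℚ; _+_; _-_; _*_; _/_; _≤_; ∣_∣; ½)
open import Data.List using (List; []; _∷_; filter; length; foldr; map)
open import Data.List.Relation.Unary.All using (All)
open import Data.Bool using (if_then_else_)
open import Data.List.Membership.Propositional using (_∈_)
open import Data.Product using (_×_; ∃-syntax)
open import Relation.Nullary using (Dec; does)
open import Relation.Nullary.Decidable using (_×-dec_)
open import Relation.Binary.PropositionalEquality using (_≡_)

-- Σ_{k ∈ [n]} f k  (points of [n] are Fin n, with Fin-value k standing for k+1)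
sumFin : ∀ {n} → (Fin n → ℚ) → ℚ
sumFin {zero}  f = 0ℚ
sumFin {suc n} f = f Fin.zero + sumFin (λ k → f (Fin.suc k))

sumList : {A : Set} → (A → ℚ) → List A → ℚ
sumList f xs = foldr (λ x acc → f x + acc) 0ℚ xs

IsDistribution : ∀ {n} → (Fin n → ℚ) → Set
IsDistribution {n} p = (∀ k → (0ℚ ≤ p k × p k ≤ 1ℚ)) × sumFin p ≡ 1ℚ

dTV : ∀ {n} → (Fin n → ℚ) → (Fin n → ℚ) → ℚ
dTV p q = ½ * sumFin (λ k → ∣ p k - q k ∣)

record Interval : Set where
  constructor [_,_]
  field
    lo : ℕ
    hi : ℕ
open Interval public

-- membership of the point k (i.e. the integer toℕ k + 1) of [n] in an interval
_∈I_ : ∀ {n} → Fin n → Interval → Set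
k ∈I I = lo I ℕ.≤ suc (toℕ k) × suc (toℕ k) ℕ.≤ hi I

_∈I?_ : ∀ {n} (k : Fin n) (I : Interval) → Dec (k ∈I I)
k ∈I? I = (lo I ≤? suc (toℕ k)) ×-dec (suc (toℕ k) ≤? hi I)

WellFormedIn : ℕ → Interval → Set
WellFormedIn n I = 1 ℕ.≤ lo I × lo I ℕ.≤ hi I × hi I ℕ.≤ n

size : Interval → ℕ
size I = suc (hi I ∸ lo I)

IsIntervalPartition : ℕ → List Interval → Set
IsIntervalPartition n 𝓘 =
  All (WellFormedIn n) 𝓘 ×
  (∀ (k : Fin n) → length (filter (λ I → k ∈I? I) 𝓘) ≡ 1)

mass : ∀ {n} → (Fin n → ℚ) → Interval → ℚ
mass p I = sumFin (λ k → if does (k ∈I? I) then p k else 0ℚ)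

-- flattened distribution (p_f)^𝓘 : (p_f)^𝓘(k) = p(I)/|I| for the (unique,
-- when 𝓘 is a partition) interval I ∈ 𝓘 containing k
flatten : ∀ {n} → List Interval → (Fin n → ℚ) → (Fin n → ℚ)
flatten 𝓘 p k =
  sumList (λ I → if does (k ∈I? I) then mass p I * ((+ 1) / size I) else 0ℚ) 𝓘

IsFlatDecomposition : (n : ℕ) → (Fin n → ℚ) → ℚ → ℕ → List Interval → Set
IsFlatDecomposition n p ε ℓ 𝓘 =
  IsIntervalPartition n 𝓘 × length 𝓘 ≡ ℓ × dTV p (flatten 𝓘 p) ≤ ε

-- 𝓙 refines 𝓘: every I ∈ 𝓘 is a union of intervals of 𝓙
Refines : ∀ {n} → List Interval → List Interval → Set
Refines {n} 𝓙 𝓘 =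
  ∀ I → I ∈ 𝓘 → ∀ (k : Fin n) → k ∈I I →
    ∃[ J ] (J ∈ 𝓙 × k ∈I J × (∀ (m : Fin n) → m ∈I J → m ∈I I))

{-# OPTIONS --safe #-}
module Submission where

-- Let J be a block of 𝓙 and I the block of 𝓘 containing it.  On J the coarse flattening is
-- the constant c = p(I)/|I| and the fine one is the average d = p(J)/|J| of p over J.  By the
-- triangle inequality Σ_{k∈J} |p k − d| ≤ Σ_{k∈J} |p k − c| + |J|·|c − d|, and since d is the
-- average, |J|·|c − d| = |Σ_{k∈J} (c − p k)| ≤ Σ_{k∈J} |p k − c|.  So on every block of 𝓙 the
-- ℓ¹ distance from p to its 𝓙-flattening is at most twice that to its 𝓘-flattening; summing
-- over the blocks of 𝓙 doubles d_TV.

open import Defs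
open import Algebra.Bundles using (CommutativeRing)
open import Data.Bool using (true; false; if_then_else_)
open import Data.Fin as Fin using (Fin; fromℕ<)
open import Data.Fin.Properties using (toℕ-fromℕ<)
open import Data.Integer as ℤ using (+_)
import Data.Integer.Properties as ℤ
open import Data.List using (List; []; _∷_; filter; length)
open import Data.List.Membership.Propositional using (_∈_)
open import Data.List.Membership.Propositional.Properties using (∈-filter⁺; ∈-filter⁻)
open import Data.List.Properties using (∷-injectiveˡ)
open import Data.List.Relation.Unary.All using (lookup)
open import Data.List.Relation.Unary.Any using (here; there)
open import Data.Nat as ℕ using (ℕ; zero; suc; _∸_; z≤n; s≤s)
import Data.Nat.Properties as ℕ
open import Function using (_∘_)
open import Data.Product using (∃; ∃-syntax; _×_; _,_)
open import Data.Rational using (ℚ; 0ℚ; 1ℚ; _+_; _*_; -_; _-_; _/_; _≤_; ∣_∣; ½; toℚᵘ)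
open import Data.Rational.Properties
import Data.Rational.Unnormalised as ℚᵘ
import Data.Rational.Unnormalised.Properties as ℚᵘ
open import Data.Rational.Solver using (module +-*-Solver)
open import Relation.Nullary using (Dec; yes; no; does)
open import Relation.Unary using (Decidable)
open import Relation.Binary.PropositionalEquality
  using (_≡_; refl; sym; trans; cong; cong₂; subst; module ≡-Reasoning)
open import Algebra.Properties.Semiring.Mult (CommutativeRing.semiring +-*-commutativeRing)
  using (×-assoc-*; ×-comm-*) renaming (_×_ to _×ℚ_)

open +-*-Solver using (solve; _:+_; _:-_; :-_; _:*_; _:=_)

∣p-q∣≡∣q-p∣ : ∀ p q → ∣ p - q ∣ ≡ ∣ q - p ∣
∣p-q∣≡∣q-p∣ p q = trans (sym (∣-p∣≡∣p∣ (p - q)))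
  (cong ∣_∣ (solve 2 (λ p q → :- (p :- q) := q :- p) refl p q))

∣p-r∣≤∣p-q∣+∣q-r∣ : ∀ p q r → ∣ p - r ∣ ≤ ∣ p - q ∣ + ∣ q - r ∣
∣p-r∣≤∣p-q∣+∣q-r∣ p q r = subst (_≤ ∣ p - q ∣ + ∣ q - r ∣)
  (cong ∣_∣ (solve 3 (λ p q r → (p :- q) :+ (q :- r) := p :- r) refl p q r))
  (∣p+q∣≤∣p∣+∣q∣ (p - q) (q - r))

n×1≡n/1 : ∀ k → k ×ℚ 1ℚ ≡ + k / 1
n×1≡n/1 zero    = refl
n×1≡n/1 (suc k) = trans (cong (_+_ 1ℚ) (n×1≡n/1 k)) (toℚᵘ-injective (begin-equality
  toℚᵘ (1ℚ + + k / 1)                       ≃⟨ toℚᵘ-homo-+ 1ℚ (+ k / 1) ⟩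
  ℚᵘ.1ℚᵘ ℚᵘ.+ toℚᵘ (+ k / 1)                ≃⟨ ℚᵘ.+-congʳ ℚᵘ.1ℚᵘ (toℚᵘ-fromℚᵘ (ℚᵘ.mkℚᵘ (+ k) 0)) ⟩
  ℚᵘ.1ℚᵘ ℚᵘ.+ ℚᵘ.mkℚᵘ (+ k) 0               ≃⟨ 1+k≃suc-k ⟩
  ℚᵘ.mkℚᵘ (+ suc k) 0                       ≃⟨ toℚᵘ-fromℚᵘ (ℚᵘ.mkℚᵘ (+ suc k) 0) ⟨
  toℚᵘ (+ suc k / 1)                        ∎))
  where
  open ℚᵘ.≤-Reasoning
  1+k≃suc-k : ℚᵘ.1ℚᵘ ℚᵘ.+ ℚᵘ.mkℚᵘ (+ k) 0 ℚᵘ.≃ ℚᵘ.mkℚᵘ (+ suc k) 0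
  1+k≃suc-k = ℚᵘ.*≡* (trans (ℤ.*-identityʳ _)
    (trans (cong (ℤ._+_ (+ 1)) (ℤ.*-identityʳ (+ k))) (sym (ℤ.*-identityʳ _))))

n×p≡[n×1]*p : ∀ k p → k ×ℚ p ≡ (k ×ℚ 1ℚ) * p
n×p≡[n×1]*p k p = trans (cong (k ×ℚ_) (sym (*-identityˡ p))) (sym (×-assoc-* k 1ℚ p))

0≤n×1 : ∀ k → 0ℚ ≤ k ×ℚ 1ℚ
0≤n×1 k = subst (0ℚ ≤_) (sym (n×1≡n/1 k)) (nonNegative⁻¹ (+ k / 1) {{normalize-nonNeg k 1}})

n×[1/n]≡1 : ∀ m → suc m ×ℚ (+ 1 / suc m) ≡ 1ℚ
n×[1/n]≡1 m = trans (n×p≡[n×1]*p (suc m) (+ 1 / suc m))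
  (trans (cong (_* (+ 1 / suc m)) (n×1≡n/1 (suc m))) (toℚᵘ-injective (begin-equality
    toℚᵘ (+ suc m / 1 * (+ 1 / suc m))            ≃⟨ toℚᵘ-homo-* (+ suc m / 1) (+ 1 / suc m) ⟩
    toℚᵘ (+ suc m / 1) ℚᵘ.* toℚᵘ (+ 1 / suc m)
      ≃⟨ ℚᵘ.*-cong (toℚᵘ-fromℚᵘ m/1) (toℚᵘ-fromℚᵘ (ℚᵘ.1/ m/1)) ⟩
    m/1 ℚᵘ.* ℚᵘ.1/ m/1                            ≃⟨ ℚᵘ.*-inverseʳ m/1 ⟩
    ℚᵘ.1ℚᵘ                                        ∎)))
  where
  open ℚᵘ.≤-Reasoning
  m/1 : ℚᵘ.ℚᵘ
  m/1 = ℚᵘ.mkℚᵘ (+ suc m) 0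

∣n×p-n×q∣≡n×∣p-q∣ : ∀ k p q → ∣ k ×ℚ p - k ×ℚ q ∣ ≡ k ×ℚ ∣ p - q ∣
∣n×p-n×q∣≡n×∣p-q∣ k p q = begin
  ∣ k ×ℚ p - k ×ℚ q ∣  ≡⟨ cong₂ (λ x y → ∣ x - y ∣) (n×p≡[n×1]*p k p) (n×p≡[n×1]*p k q) ⟩
  ∣ N * p - N * q ∣    ≡⟨ cong ∣_∣ (solve 3 (λ N p q → N :* p :- N :* q := N :* (p :- q)) refl N p q) ⟩
  ∣ N * (p - q) ∣      ≡⟨ ∣p*q∣≡∣p∣*∣q∣ N (p - q) ⟩
  ∣ N ∣ * ∣ p - q ∣    ≡⟨ cong (_* ∣ p - q ∣) (0≤p⇒∣p∣≡p (0≤n×1 k)) ⟩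
  N * ∣ p - q ∣        ≡⟨ n×p≡[n×1]*p k ∣ p - q ∣ ⟨
  k ×ℚ ∣ p - q ∣       ∎
  where
  open ≡-Reasoning
  N : ℚ
  N = k ×ℚ 1ℚ

sumFin-cong : ∀ {n} {f g : Fin n → ℚ} → (∀ k → f k ≡ g k) → sumFin f ≡ sumFin g
sumFin-cong {zero}  f≗g = refl
sumFin-cong {suc n} f≗g = cong₂ _+_ (f≗g Fin.zero) (sumFin-cong (λ k → f≗g (Fin.suc k)))

sumFin-zero : ∀ n → sumFin {n} (λ _ → 0ℚ) ≡ 0ℚ
sumFin-zero zero    = refl
sumFin-zero (suc n) = trans (+-identityˡ _) (sumFin-zero n)

sumFin-+ : ∀ {n} (f g : Fin n → ℚ) → sumFin (λ k → f k + g k) ≡ sumFin f + sumFin g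
sumFin-+ {zero}  f g = sym (+-identityˡ 0ℚ)
sumFin-+ {suc n} f g =
  trans (cong (_+_ (f Fin.zero + g Fin.zero)) (sumFin-+ (f ∘ Fin.suc) (g ∘ Fin.suc)))
  (solve 4 (λ a b c d → (a :+ b) :+ (c :+ d) := (a :+ c) :+ (b :+ d)) refl
    (f Fin.zero) (g Fin.zero) (sumFin (f ∘ Fin.suc)) (sumFin (g ∘ Fin.suc)))

sumFin-neg : ∀ {n} (f : Fin n → ℚ) → sumFin (λ k → - f k) ≡ - sumFin f
sumFin-neg {zero}  f = refl
sumFin-neg {suc n} f = trans (cong (_+_ (- f Fin.zero)) (sumFin-neg (f ∘ Fin.suc)))
  (sym (neg-distrib-+ (f Fin.zero) (sumFin (f ∘ Fin.suc))))

sumFin-mono-≤ : ∀ {n} {f g : Fin n → ℚ} → (∀ k → f k ≤ g k) → sumFin f ≤ sumFin g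
sumFin-mono-≤ {zero}  f≤g = ≤-refl
sumFin-mono-≤ {suc n} f≤g = +-mono-≤ (f≤g Fin.zero) (sumFin-mono-≤ (λ k → f≤g (Fin.suc k)))

∣sumFin∣≤sumFin∣∣ : ∀ {n} (f : Fin n → ℚ) → ∣ sumFin f ∣ ≤ sumFin (λ k → ∣ f k ∣)
∣sumFin∣≤sumFin∣∣ {zero}  f = ≤-refl
∣sumFin∣≤sumFin∣∣ {suc n} f = ≤-trans (∣p+q∣≤∣p∣+∣q∣ (f Fin.zero) (sumFin (f ∘ Fin.suc)))
  (+-monoʳ-≤ ∣ f Fin.zero ∣ (∣sumFin∣≤sumFin∣∣ (f ∘ Fin.suc)))

sumList-+ : ∀ {A : Set} (f g : A → ℚ) xs →
  sumList (λ x → f x + g x) xs ≡ sumList f xs + sumList g xs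
sumList-+ f g []       = sym (+-identityˡ 0ℚ)
sumList-+ f g (x ∷ xs) = trans (cong (_+_ (f x + g x)) (sumList-+ f g xs))
  (solve 4 (λ a b c d → (a :+ b) :+ (c :+ d) := (a :+ c) :+ (b :+ d)) refl
    (f x) (g x) (sumList f xs) (sumList g xs))

sumList-mono-≤ : ∀ {A : Set} {f g : A → ℚ} xs →
  (∀ x → x ∈ xs → f x ≤ g x) → sumList f xs ≤ sumList g xs
sumList-mono-≤ []       f≤g = ≤-refl
sumList-mono-≤ (x ∷ xs) f≤g =
  +-mono-≤ (f≤g x (here refl)) (sumList-mono-≤ xs (λ y y∈xs → f≤g y (there y∈xs)))

sumFin-sumList-comm : ∀ {n} {A : Set} (g : A → Fin n → ℚ) xs →
  sumFin (λ k → sumList (λ x → g x k) xs) ≡ sumList (λ x → sumFin (g x)) xs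
sumFin-sumList-comm {n} g []       = sumFin-zero n
sumFin-sumList-comm     g (x ∷ xs) = trans (sumFin-+ (g x) (λ k → sumList (λ y → g y k) xs))
  (cong (_+_ (sumFin (g x))) (sumFin-sumList-comm g xs))

length≡1⇒singleton : ∀ {A : Set} {xs : List A} → length xs ≡ 1 → ∃ λ x → xs ≡ x ∷ []
length≡1⇒singleton {xs = x ∷ []} refl = x , refl

module _ {A : Set} {P : A → Set} (P? : Decidable P) where

  sumList-if≡sumList-filter : ∀ (g : A → ℚ) xs →
    sumList (λ x → if does (P? x) then g x else 0ℚ) xs ≡ sumList g (filter P? xs)
  sumList-if≡sumList-filter g []       = refl
  sumList-if≡sumList-filter g (x ∷ xs) with does (P? x)
  ... | true  = cong (_+_ (g x)) (sumList-if≡sumList-filter g xs)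
  ... | false = trans (+-identityˡ _) (sumList-if≡sumList-filter g xs)

  module _ {xs : List A} (unique : length (filter P? xs) ≡ 1) where

    filter≡[y] : ∀ {y} → y ∈ xs → P y → filter P? xs ≡ y ∷ []
    filter≡[y] {y} y∈xs py with length≡1⇒singleton unique
    ... | w , filter≡[w] with subst (y ∈_) filter≡[w] (∈-filter⁺ P? y∈xs py)
    ... | here refl = filter≡[w]

    witness : ∃ λ y → y ∈ xs × P y
    witness with length≡1⇒singleton unique
    ... | w , filter≡[w] = w , ∈-filter⁻ P? (subst (w ∈_) (sym filter≡[w]) (here refl))

    witness-unique : ∀ {y z} → y ∈ xs → P y → z ∈ xs → P z → y ≡ z
    witness-unique y∈xs py z∈xs pz =
      ∷-injectiveˡ (trans (sym (filter≡[y] y∈xs py)) (filter≡[y] z∈xs pz))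

    sumList-select : ∀ (g : A → ℚ) {y} → y ∈ xs → P y →
      sumList (λ x → if does (P? x) then g x else 0ℚ) xs ≡ g y
    sumList-select g y∈xs py = trans (sumList-if≡sumList-filter g xs)
      (trans (cong (sumList g) (filter≡[y] y∈xs py)) (+-identityʳ _))

sumOn : ∀ {n} → Interval → (Fin n → ℚ) → ℚ
sumOn J f = sumFin (λ k → if does (k ∈I? J) then f k else 0ℚ)

if-cong : ∀ {P : Set} (d : Dec P) {x y : ℚ} → (P → x ≡ y) →
  (if does d then x else 0ℚ) ≡ (if does d then y else 0ℚ)
if-cong (yes p) x≡y = x≡y p
if-cong (no _)  _   = refl

if-+ : ∀ b x y → (if b then x + y else 0ℚ) ≡ (if b then x else 0ℚ) + (if b then y else 0ℚ)
if-+ true  x y = refl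
if-+ false x y = refl

if-- : ∀ b x y → (if b then x - y else 0ℚ) ≡ (if b then x else 0ℚ) - (if b then y else 0ℚ)
if-- true  x y = refl
if-- false x y = refl

if-∣∣ : ∀ b x → ∣ if b then x else 0ℚ ∣ ≡ (if b then ∣ x ∣ else 0ℚ)
if-∣∣ true  x = refl
if-∣∣ false x = refl

if-mono-≤ : ∀ b {x y} → x ≤ y → (if b then x else 0ℚ) ≤ (if b then y else 0ℚ)
if-mono-≤ true  x≤y = x≤y
if-mono-≤ false _   = ≤-refl

sumOn-cong : ∀ {n} J {f g : Fin n → ℚ} → (∀ k → k ∈I J → f k ≡ g k) → sumOn J f ≡ sumOn J g
sumOn-cong {n} J f≗g = sumFin-cong {n} (λ k → if-cong (k ∈I? J) (f≗g k))

sumOn-mono-≤ : ∀ {n} J {f g : Fin n → ℚ} → (∀ k → f k ≤ g k) → sumOn J f ≤ sumOn J g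
sumOn-mono-≤ {n} J f≤g = sumFin-mono-≤ {n} (λ k → if-mono-≤ (does (k ∈I? J)) (f≤g k))

sumOn-+ : ∀ {n} J (f g : Fin n → ℚ) → sumOn J (λ k → f k + g k) ≡ sumOn J f + sumOn J g
sumOn-+ {n} J f g =
  trans (sumFin-cong {n} (λ k → if-+ (does (k ∈I? J)) (f k) (g k))) (sumFin-+ {n} _ _)

sumOn-- : ∀ {n} J (f g : Fin n → ℚ) → sumOn J (λ k → f k - g k) ≡ sumOn J f - sumOn J g
sumOn-- {n} J f g = trans (sumFin-cong {n} (λ k → if-- (does (k ∈I? J)) (f k) (g k)))
  (trans (sumFin-+ {n} _ _) (cong (_+_ (sumOn J f)) (sumFin-neg {n} _)))

∣sumOn∣≤sumOn∣∣ : ∀ {n} J (f : Fin n → ℚ) → ∣ sumOn J f ∣ ≤ sumOn J (λ k → ∣ f k ∣)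
∣sumOn∣≤sumOn∣∣ {n} J f = ≤-trans (∣sumFin∣≤sumFin∣∣ {n} _)
  (≤-reflexive (sumFin-cong {n} (λ k → if-∣∣ (does (k ∈I? J)) (f k))))

-- Each recursive call peels off the point 1 of [n+1]; the remaining points k+1 lie in
-- [lo+1, hi+1] exactly when k lies in [lo, hi], and Agda sees this by computation.
sumOn-[lo,hi]-const : ∀ n lo hi x → 1 ℕ.≤ lo → lo ℕ.≤ suc hi → hi ℕ.≤ n →
  sumOn {n} [ lo , hi ] (λ _ → x) ≡ (suc hi ∸ lo) ×ℚ x
sumOn-[lo,hi]-const zero    1             zero    x _ _ _ = refl
sumOn-[lo,hi]-const (suc n) 1             zero    x _ _ _ =
  trans (+-identityˡ _) (sumOn-[lo,hi]-const n 1 0 x (s≤s z≤n) (s≤s z≤n) z≤n)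
sumOn-[lo,hi]-const (suc n) 1             (suc h) x _ _ (s≤s h≤n) =
  cong (_+_ x) (sumOn-[lo,hi]-const n 1 h x (s≤s z≤n) (s≤s z≤n) h≤n)
sumOn-[lo,hi]-const (suc n) (suc (suc l)) (suc h) x _ (s≤s l<h) (s≤s h≤n) =
  trans (+-identityˡ _) (sumOn-[lo,hi]-const n (suc l) h x (s≤s z≤n) l<h h≤n)
sumOn-[lo,hi]-const _       (suc (suc l)) zero    x _ (s≤s ()) _

sumOn-const : ∀ {n} {J} x → WellFormedIn n J → sumOn {n} J (λ _ → x) ≡ size J ×ℚ x
sumOn-const {n} {[ lo , hi ]} x (1≤lo , lo≤hi , hi≤n) =
  trans (sumOn-[lo,hi]-const n lo hi x 1≤lo (ℕ.m≤n⇒m≤1+n lo≤hi) hi≤n)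
    (cong (_×ℚ x) (ℕ.+-∸-assoc 1 lo≤hi))

average : ∀ {n} → (Fin n → ℚ) → Interval → ℚ
average p I = mass p I * (+ 1 / size I)

size×average≡mass : ∀ {n} (p : Fin n → ℚ) I → size I ×ℚ average p I ≡ mass p I
size×average≡mass p I = trans (sym (×-comm-* (size I) (mass p I) (+ 1 / size I)))
  (trans (cong (mass p I *_) (n×[1/n]≡1 (hi I ∸ lo I))) (*-identityʳ (mass p I)))

distOn : ∀ {n} → Interval → (Fin n → ℚ) → (Fin n → ℚ) → ℚ
distOn J f g = sumOn J (λ k → ∣ f k - g k ∣)

distOn-average≤2×distOn : ∀ {n} (p : Fin n → ℚ) {J} → WellFormedIn n J → ∀ c →
  distOn J p (λ _ → average p J) ≤ distOn J p (λ _ → c) + distOn J p (λ _ → c)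
distOn-average≤2×distOn {n} p {J} wf c = begin
  distOn J p (λ _ → d)                          ≤⟨ sumOn-mono-≤ J (λ k → ∣p-r∣≤∣p-q∣+∣q-r∣ (p k) c d) ⟩
  sumOn J (λ k → ∣ p k - c ∣ + ∣ c - d ∣)       ≡⟨ sumOn-+ J (λ k → ∣ p k - c ∣) (λ _ → ∣ c - d ∣) ⟩
  dist-c + sumOn {n} J (λ _ → ∣ c - d ∣)        ≡⟨ cong (_+_ dist-c) (sumOn-const ∣ c - d ∣ wf) ⟩
  dist-c + size J ×ℚ ∣ c - d ∣                  ≤⟨ +-monoʳ-≤ dist-c size×∣c-d∣≤dist-c ⟩
  dist-c + dist-c                               ∎
  where
  open ≤-Reasoning
  d dist-c : ℚ
  d = average p J
  dist-c = distOn J p (λ _ → c)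
  size×∣c-d∣≤dist-c : size J ×ℚ ∣ c - d ∣ ≤ dist-c
  size×∣c-d∣≤dist-c = begin
    size J ×ℚ ∣ c - d ∣                   ≡⟨ ∣n×p-n×q∣≡n×∣p-q∣ (size J) c d ⟨
    ∣ size J ×ℚ c - size J ×ℚ d ∣
      ≡⟨ cong₂ (λ x y → ∣ x - y ∣) (sumOn-const c wf) (sym (size×average≡mass p J)) ⟨
    ∣ sumOn {n} J (λ _ → c) - mass p J ∣  ≡⟨ cong ∣_∣ (sumOn-- J (λ _ → c) p) ⟨
    ∣ sumOn J (λ k → c - p k) ∣           ≤⟨ ∣sumOn∣≤sumOn∣∣ J (λ k → c - p k) ⟩
    sumOn J (λ k → ∣ c - p k ∣)           ≡⟨ sumOn-cong J (λ k _ → ∣p-q∣≡∣q-p∣ c (p k)) ⟩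
    dist-c                                ∎

CoversUniquely : (n : ℕ) → List Interval → Set
CoversUniquely n 𝓙 = ∀ (k : Fin n) → length (filter (k ∈I?_) 𝓙) ≡ 1

wellFormed⇒inhabited : ∀ {n} J → WellFormedIn n J → ∃ λ (k : Fin n) → k ∈I J
wellFormed⇒inhabited [ suc l , hi ] (s≤s z≤n , l<hi , hi≤n) = fromℕ< l<n , k∈J
  where
  l<n : l ℕ.< _
  l<n = ℕ.≤-trans l<hi hi≤n
  k∈J : fromℕ< l<n ∈I [ suc l , hi ]
  k∈J rewrite toℕ-fromℕ< l<n = ℕ.≤-refl , l<hi

flatten-on-block : ∀ {n} {𝓙} (p : Fin n → ℚ) → CoversUniquely n 𝓙 →
  ∀ {J k} → J ∈ 𝓙 → k ∈I J → flatten 𝓙 p k ≡ average p J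
flatten-on-block {𝓙 = 𝓙} p cover {J} {k} J∈𝓙 k∈J =
  sumList-select (k ∈I?_) {𝓙} (cover k) (average p) J∈𝓙 k∈J

sumFin-partition : ∀ {n} 𝓙 → CoversUniquely n 𝓙 →
  ∀ (f : Fin n → ℚ) → sumFin f ≡ sumList (λ J → sumOn J f) 𝓙
sumFin-partition {n} 𝓙 cover f = trans (sumFin-cong {n} split)
  (sumFin-sumList-comm (λ J k → if does (k ∈I? J) then f k else 0ℚ) 𝓙)
  where
  split : ∀ k → f k ≡ sumList (λ J → if does (k ∈I? J) then f k else 0ℚ) 𝓙
  split k with witness (k ∈I?_) {𝓙} (cover k)
  ... | J , J∈𝓙 , k∈J = sym (sumList-select (k ∈I?_) {𝓙} (cover k) (λ _ → f k) J∈𝓙 k∈J)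

refinement-block-⊆ : ∀ {n} {𝓘 𝓙} → CoversUniquely n 𝓘 → CoversUniquely n 𝓙 → Refines {n} 𝓙 𝓘 →
  ∀ {J} → J ∈ 𝓙 → WellFormedIn n J → ∃[ I ] (I ∈ 𝓘 × (∀ (m : Fin n) → m ∈I J → m ∈I I))
refinement-block-⊆ {𝓘 = 𝓘} {𝓙} cover𝓘 cover𝓙 refines {J} J∈𝓙 wf
  with k , k∈J ← wellFormed⇒inhabited J wf
  with I , I∈𝓘 , k∈I ← witness (k ∈I?_) {𝓘} (cover𝓘 k)
  with J′ , J′∈𝓙 , k∈J′ , J′⊆I ← refines I I∈𝓘 k k∈I
  with refl ← witness-unique (k ∈I?_) {𝓙} (cover𝓙 k) J∈𝓙 k∈J J′∈𝓙 k∈J′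
  = I , I∈𝓘 , J′⊆I

distOn-refinement-block : ∀ {n} (p : Fin n → ℚ) {𝓘 𝓙} →
  CoversUniquely n 𝓘 → CoversUniquely n 𝓙 → Refines {n} 𝓙 𝓘 → ∀ {J} → J ∈ 𝓙 → WellFormedIn n J →
  distOn J p (flatten 𝓙 p) ≤ distOn J p (flatten 𝓘 p) + distOn J p (flatten 𝓘 p)
distOn-refinement-block p {𝓘} {𝓙} cover𝓘 cover𝓙 refines {J} J∈𝓙 wf
  with I , I∈𝓘 , J⊆I ← refinement-block-⊆ cover𝓘 cover𝓙 refines J∈𝓙 wf = begin
    distOn J p (flatten 𝓙 p)                  ≡⟨ flat-on-J 𝓙 cover𝓙 J∈𝓙 (λ _ k∈J → k∈J) ⟩
    distOn J p (λ _ → average p J)            ≤⟨ distOn-average≤2×distOn p wf (average p I) ⟩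
    distOn J p (λ _ → average p I) + distOn J p (λ _ → average p I)
      ≡⟨ cong₂ _+_ (flat-on-J 𝓘 cover𝓘 I∈𝓘 J⊆I) (flat-on-J 𝓘 cover𝓘 I∈𝓘 J⊆I) ⟨
    distOn J p (flatten 𝓘 p) + distOn J p (flatten 𝓘 p) ∎
  where
  open ≤-Reasoning
  flat-on-J : ∀ 𝓚 → CoversUniquely _ 𝓚 → ∀ {K} → K ∈ 𝓚 → (∀ m → m ∈I J → m ∈I K) →
    distOn J p (flatten 𝓚 p) ≡ distOn J p (λ _ → average p K)
  flat-on-J 𝓚 cover K∈𝓚 J⊆K =
    sumOn-cong J (λ k k∈J → cong (λ x → ∣ p k - x ∣) (flatten-on-block p cover K∈𝓚 (J⊆K k k∈J)))

dTV-refinement : ∀ {n} (p : Fin n → ℚ) {𝓘 𝓙} →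
  CoversUniquely n 𝓘 → IsIntervalPartition n 𝓙 → Refines {n} 𝓙 𝓘 →
  dTV p (flatten 𝓙 p) ≤ dTV p (flatten 𝓘 p) + dTV p (flatten 𝓘 p)
dTV-refinement p {𝓘} {𝓙} cover𝓘 (wf𝓙 , cover𝓙) refines = begin
  ½ * ∑∣p-r∣                                    ≡⟨ cong (½ *_) (sumFin-partition 𝓙 cover𝓙 _) ⟩
  ½ * sumList (λ J → distOn J p r) 𝓙
    ≤⟨ *-monoˡ-≤-nonNeg ½ (sumList-mono-≤ 𝓙 on-blocks) ⟩
  ½ * sumList (λ J → distOn J p q + distOn J p q) 𝓙
    ≡⟨ cong (½ *_) (sumList-+ (λ J → distOn J p q) _ 𝓙) ⟩
  ½ * (sumList (λ J → distOn J p q) 𝓙 + sumList (λ J → distOn J p q) 𝓙)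
    ≡⟨ cong (λ x → ½ * (x + x)) (sumFin-partition 𝓙 cover𝓙 _) ⟨
  ½ * (∑∣p-q∣ + ∑∣p-q∣)                         ≡⟨ *-distribˡ-+ ½ ∑∣p-q∣ ∑∣p-q∣ ⟩
  ½ * ∑∣p-q∣ + ½ * ∑∣p-q∣                       ∎
  where
  open ≤-Reasoning
  q r : Fin _ → ℚ
  q = flatten 𝓘 p
  r = flatten 𝓙 p
  ∑∣p-q∣ ∑∣p-r∣ : ℚ
  ∑∣p-q∣ = sumFin (λ k → ∣ p k - q k ∣)
  ∑∣p-r∣ = sumFin (λ k → ∣ p k - r k ∣)
  on-blocks : ∀ J → J ∈ 𝓙 → distOn J p r ≤ distOn J p q + distOn J p q
  on-blocks J J∈𝓙 = distOn-refinement-block p cover𝓘 cover𝓙 refines J∈𝓙 (lookup wf𝓙 J∈𝓙)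

mainTheorem4 : (n : ℕ) (p : Fin n → ℚ) → IsDistribution p →
    (ε : ℚ) (a b : ℕ) (𝓘 𝓙 : List Interval) →
    IsFlatDecomposition n p ε a 𝓘 →
    IsIntervalPartition n 𝓙 → length 𝓙 ≡ b → Refines {n} 𝓙 𝓘 →
    IsFlatDecomposition n p (ε + ε) b 𝓙
mainTheorem4 n p _ ε a b 𝓘 𝓙 ((_ , cover𝓘) , _ , dTV≤ε) partition𝓙 |𝓙|≡b refines =
  partition𝓙 , |𝓙|≡b ,
  ≤-trans (dTV-refinement p cover𝓘 partition𝓙 refines) (+-mono-≤ dTV≤ε dTV≤ε)
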